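{- Let $r\ge 2$, $k$ and $n$ be integers with $n\ge 108(r+1)^r k$ and $k\ge f(r)$, where $f(r)=2r+1$ if $r=2$ and $f(r)=3r+4$ if $r\ge 3$. Let $G$ be a graph on $n$ vertices containing no cycle of length $2k+1$ as a subgraph, with $\delta(G)\ge \frac{n}{2r+2}$. If $H$ is a $2k$-core of $G$, then $|V(H)|\le 2r+2$.
   Context: $\delta(G)$ is the minimum degree. A path is even (odd) if its number of vertices is even (odd); the order of a path is its number of vertices. A subgraph $H$ of $G$ is a $2k$-core of $G$ if for each pair of vertices $x,y\in V(H)$ there exists an even path in $H$ with end vertices $x,y$ of order at most $2k$. -}

module Defs where

open import Data.Nat using (ℕ; zero; suc; _+_; _*_; _≤_)
open import Data.Bool using (Bool; true; false)
open import Data.Fin using (Fin; zero; suc; inject₁; fromℕ)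
open import Data.Fin.Subset using (Subset; _∈_; ∣_∣)
open import Data.Vec using (tabulate)
open import Data.Product using (Σ; ∃; _×_)
open import Function.Definitions using (Injective)
open import Relation.Binary.PropositionalEquality using (_≡_)
open import Relation.Nullary using (¬_)

record Graph (n : ℕ) : Set where
  field
    adj     : Fin n → Fin n → Bool
    sym     : ∀ u v → adj u v ≡ adj v u
    irrefl  : ∀ v → adj v v ≡ false

open Graph public

N : ∀ {n} → Graph n → Fin n → Subset n
N G v = tabulate (adj G v)

deg : ∀ {n} → Graph n → Fin n → ℕ
deg G v = ∣ N G v ∣

-- δ(G) ≥ n / d, written without division:  d * deg v ≥ n for every v
MinDegAtLeastFrac : ∀ {n} → Graph n → (d : ℕ) → Set
MinDegAtLeastFrac {n} G d = ∀ v → n ≤ d * deg G v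

-- G contains a cycle of length (suc l) as a subgraph (meaningful for suc l ≥ 3):
-- an injective sequence c₀,…,c_l of vertices with consecutive ones adjacent
-- and c_l adjacent to c₀.
HasCycle : ∀ {n} → Graph n → (l : ℕ) → Set
HasCycle {n} G l =
  Σ (Fin (suc l) → Fin n) λ c →
    Injective _≡_ _≡_ c ×
    (∀ (i : Fin l) → adj G (c (inject₁ i)) (c (suc i)) ≡ true) ×
    adj G (c (fromℕ l)) (c zero) ≡ true

record Subgraph {n : ℕ} (G : Graph n) : Set₁ where
  field
    V      : Subset n
    E      : Fin n → Fin n → Set
    E-sym  : ∀ u v → E u v → E v u
    E-sub  : ∀ u v → E u v → (u ∈ V) × (v ∈ V) × (adj G u v ≡ true)

open Subgraph public

-- A path in H of order (number of vertices) m = suc l from x to y.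
PathIn : ∀ {n} {G : Graph n} → Subgraph G → (l : ℕ) → Fin n → Fin n → Set
PathIn {n} H l x y =
  Σ (Fin (suc l) → Fin n) λ p →
    Injective _≡_ _≡_ p ×
    (∀ (i : Fin l) → E H (p (inject₁ i)) (p (suc i))) ×
    p zero ≡ x × p (fromℕ l) ≡ y

EvenPathAtMost : ∀ {n} {G : Graph n} → Subgraph G → ℕ → Fin n → Fin n → Set
EvenPathAtMost H k x y =
  Σ ℕ λ l → (∃ λ j → suc l ≡ 2 * j) × suc l ≤ 2 * k × PathIn H l x y

Is2kCore : ∀ {n} {G : Graph n} → ℕ → Subgraph G → Set
Is2kCore {n} k H =
  ∀ (x y : Fin n) → x ∈ V H → y ∈ V H → ¬ (x ≡ y) → EvenPathAtMost H k x y

f : ℕ → ℕ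
f 2 = 2 * 2 + 1
f r = 3 * r + 4

-- Let m = 2r + 3 and T = 2k + 2r + 2.  Double counting the neighbourhoods of any m distinct
-- vertices (Bonferroni: Σ deg ≤ n + Σ over pairs of codegrees) against δ(G) ≥ n/(2r+2) gives
-- n ≤ (2r+2)·C(m,2)·T < 108(r+1)^r k ≤ n unless two of them have more than T common neighbours.
-- So if |V(H)| ≥ m, some x ≠ y in H form such a heavy pair, and H joins y to x by an even path
-- of order 2j ≤ 2k.  A heavy pair can be joined through fresh vertices by a path with any odd
-- number 2s + 1 of interior vertices, as long as m + (number of used vertices) + 2s ≤ T + 1:
-- the common neighbourhood of the pair minus the used vertices still has m elements, hence
-- contains a heavy pair u ≠ v, and one recurses on u, v.  Taking s = k − j closes the even path
-- into a cycle of length 2k + 1.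

module Submission where

open import Defs
open import Data.Nat using (ℕ; zero; suc; _+_; _*_; _^_; _∸_; _≤_; _<_; _≤?_; z≤n; s≤s)
open import Data.Nat.Properties
open import Data.Nat.Combinatorics using (_C_; nCk+nC[k+1]≡[n+1]C[k+1]; nC1≡n)
open import Data.Nat.ListAction using (sum)
open import Data.Nat.Tactic.RingSolver using (solve)
open import Data.Bool using (true)
open import Data.Fin using (Fin; zero; suc; inject₁; fromℕ)
import Data.Fin.Properties as Fin
open import Data.Fin.Subset using (Subset; inside; outside; _∩_; _∪_; ∁; ⋃; ⁅_⁆; ∣_∣; ⊥)
  renaming (_∈_ to _∈ₛ_)
open import Data.Fin.Subset.Properties
  using (∣p∣≤n; ∣⁅x⁆∣≡1; ∣⊥∣≡0; ∣p∩q∣≤∣q∣; ∩-distribˡ-∪; x∈p∪q⁺; x∈⁅x⁆; x∈p∩q⁻; x∈∁p⇒x∉p)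
open import Data.Vec using ([]; _∷_; here; there)
open import Data.Vec.Properties using ([]=⇒lookup; lookup∘tabulate)
import Data.List as List
open import Data.List using (List; []; _∷_; _++_; length; map; take; lookup; tabulate)
open import Data.List.Properties using (length-map; length-take; length-tabulate; length-++)
open import Data.List.Membership.Propositional using (_∈_; _∉_; find)
open import Data.List.Membership.Propositional.Properties using (∈-lookup)
open import Data.List.Relation.Unary.All as All using (All; []; _∷_; all?)
import Data.List.Relation.Unary.All.Properties as All
open import Data.List.Relation.Unary.Any using (here; there)
open import Data.List.Relation.Unary.AllPairs using (AllPairs; []; _∷_)
open import Data.List.Relation.Binary.Disjoint.Propositional using (Disjoint)
open import Data.List.Relation.Unary.Unique.Propositional using (Unique)
import Data.List.Relation.Unary.Unique.Propositional.Properties as Unique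
open import Data.Product using (Σ; ∃₂; _×_; _,_; proj₂)
open import Data.Sum using (_⊎_; inj₁; inj₂)
open import Data.Unit using (tt)
open import Function using (_∘_)
open import Function.Definitions using (Injective)
open import Relation.Binary.Core using (Rel)
open import Relation.Binary.Definitions using (Decidable)
open import Relation.Binary.PropositionalEquality as ≡ using (_≡_; _≢_; refl; cong; cong₂; subst)
open import Relation.Nullary using (¬_; yes; no; contradiction)

private variable
  A I : Set
  R : Rel A _
  a b c : A
  xs ys : List A
  n : ℕ

infixr 5 _◅_ _◅◅_

data Chain (R : Rel A _) : A → List A → A → Set where
  ε   : Chain R a [] a
  _◅_ : R a b → Chain R b xs c → Chain R a (b ∷ xs) c

_◅◅_ : Chain R a xs b → Chain R b ys c → Chain R a (xs ++ ys) c
ε        ◅◅ ys = ys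
(r ◅ xs) ◅◅ ys = r ◅ (xs ◅◅ ys)

Chain-map : ∀ {S : Rel A _} → (∀ {x y} → R x y → S x y) → Chain R a xs b → Chain S a xs b
Chain-map g ε        = ε
Chain-map g (r ◅ rs) = g r ◅ Chain-map g rs

-- PathIn H is definitionally IndexedPath (E H), and HasCycle is an IndexedPath of Adj plus a
-- closing edge; walks are handled as lists, which concatenate easily.
IndexedPath : Rel A _ → ℕ → A → A → Set
IndexedPath {A} R l a b =
  Σ (Fin (suc l) → A) λ p →
    Injective _≡_ _≡_ p ×
    (∀ (i : Fin l) → R (p (inject₁ i)) (p (suc i))) ×
    p zero ≡ a × p (fromℕ l) ≡ b

lookup-injective : Unique xs → Injective _≡_ _≡_ (lookup xs)
lookup-injective (_ ∷ _)    {zero}  {zero}  _  = refl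
lookup-injective (x≢ ∷ _)   {zero}  {suc j} eq = contradiction eq (All.lookup x≢ (∈-lookup j))
lookup-injective (x≢ ∷ _)   {suc i} {zero}  eq = contradiction (≡.sym eq) (All.lookup x≢ (∈-lookup i))
lookup-injective (_ ∷ uniq) {suc i} {suc j} eq = cong suc (lookup-injective uniq eq)

Chain⇒steps : Chain R a xs b →
              ∀ (i : Fin (length xs)) → R (lookup (a ∷ xs) (inject₁ i)) (lookup (a ∷ xs) (suc i))
Chain⇒steps (r ◅ _)  zero    = r
Chain⇒steps (_ ◅ rs) (suc i) = Chain⇒steps rs i

Chain⇒last : Chain R a xs b → lookup (a ∷ xs) (fromℕ (length xs)) ≡ b
Chain⇒last ε        = refl
Chain⇒last (_ ◅ rs) = Chain⇒last rs

Chain⇒IndexedPath : Chain R a xs b → Unique (a ∷ xs) → IndexedPath R (length xs) a b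
Chain⇒IndexedPath {a = a} {xs = xs} rs uniq =
  lookup (a ∷ xs) , lookup-injective uniq , Chain⇒steps rs , refl , Chain⇒last rs

tabulate-Chain : ∀ {l} (p : Fin (suc l) → A) → (∀ (i : Fin l) → R (p (inject₁ i)) (p (suc i))) →
                 Chain R (p zero) (tabulate (p ∘ suc)) (p (fromℕ l))
tabulate-Chain {l = zero}  p steps = ε
tabulate-Chain {l = suc l} p steps = steps zero ◅ tabulate-Chain (p ∘ suc) (steps ∘ suc)

IndexedPath⇒Chain : ∀ {l} → IndexedPath R l a b →
                    Σ (List A) λ xs → Chain R a xs b × Unique (a ∷ xs) × length xs ≡ l
IndexedPath⇒Chain (p , inj , steps , refl , refl) =
  tabulate (p ∘ suc) , tabulate-Chain p steps , Unique.tabulate⁺ inj , length-tabulate (p ∘ suc)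

AllPairs-or-violation : Decidable R → ∀ xs → Unique xs →
                        AllPairs R xs ⊎ ∃₂ λ x y → x ∈ xs × y ∈ xs × x ≢ y × ¬ R x y
AllPairs-or-violation R? []       _            = inj₁ []
AllPairs-or-violation R? (x ∷ xs) (x≢ ∷ uniq) with all? (R? x) xs
... | no ¬all = let y , y∈ , ¬Rxy = find (All.¬All⇒Any¬ (R? x) xs ¬all) in
                inj₂ (x , y , here refl , there y∈ , All.lookup x≢ y∈ , ¬Rxy)
... | yes all with AllPairs-or-violation R? xs uniq
...   | inj₁ allPairs = inj₁ (all ∷ allPairs)
...   | inj₂ (y , z , y∈ , z∈ , y≢z , ¬Ryz) = inj₂ (y , z , there y∈ , there z∈ , y≢z , ¬Ryz)

∣p∪q∣+∣p∩q∣≡∣p∣+∣q∣ : ∀ (p q : Subset n) → ∣ p ∪ q ∣ + ∣ p ∩ q ∣ ≡ ∣ p ∣ + ∣ q ∣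
∣p∪q∣+∣p∩q∣≡∣p∣+∣q∣ []            []            = refl
∣p∪q∣+∣p∩q∣≡∣p∣+∣q∣ (inside  ∷ p) (inside  ∷ q) = cong suc (begin
  ∣ p ∪ q ∣ + suc ∣ p ∩ q ∣   ≡⟨ +-suc ∣ p ∪ q ∣ ∣ p ∩ q ∣ ⟩
  suc (∣ p ∪ q ∣ + ∣ p ∩ q ∣) ≡⟨ cong suc (∣p∪q∣+∣p∩q∣≡∣p∣+∣q∣ p q) ⟩
  suc (∣ p ∣ + ∣ q ∣)         ≡⟨ +-suc ∣ p ∣ ∣ q ∣ ⟨
  ∣ p ∣ + suc ∣ q ∣           ∎)
  where open ≡.≡-Reasoning
∣p∪q∣+∣p∩q∣≡∣p∣+∣q∣ (inside  ∷ p) (outside ∷ q) = cong suc (∣p∪q∣+∣p∩q∣≡∣p∣+∣q∣ p q)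
∣p∪q∣+∣p∩q∣≡∣p∣+∣q∣ (outside ∷ p) (inside  ∷ q) =
  ≡.trans (cong suc (∣p∪q∣+∣p∩q∣≡∣p∣+∣q∣ p q)) (≡.sym (+-suc ∣ p ∣ ∣ q ∣))
∣p∪q∣+∣p∩q∣≡∣p∣+∣q∣ (outside ∷ p) (outside ∷ q) = ∣p∪q∣+∣p∩q∣≡∣p∣+∣q∣ p q

∣p∪q∣≤∣p∣+∣q∣ : ∀ (p q : Subset n) → ∣ p ∪ q ∣ ≤ ∣ p ∣ + ∣ q ∣
∣p∪q∣≤∣p∣+∣q∣ p q = ≤-trans (m≤m+n ∣ p ∪ q ∣ ∣ p ∩ q ∣) (≤-reflexive (∣p∪q∣+∣p∩q∣≡∣p∣+∣q∣ p q))

∣p∣≤∣p∩∁q∣+∣q∣ : ∀ (p q : Subset n) → ∣ p ∣ ≤ ∣ p ∩ ∁ q ∣ + ∣ q ∣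
∣p∣≤∣p∩∁q∣+∣q∣ []            []            = z≤n
∣p∣≤∣p∩∁q∣+∣q∣ (inside  ∷ p) (inside  ∷ q) =
  ≤-trans (s≤s (∣p∣≤∣p∩∁q∣+∣q∣ p q)) (≤-reflexive (≡.sym (+-suc ∣ p ∩ ∁ q ∣ ∣ q ∣)))
∣p∣≤∣p∩∁q∣+∣q∣ (inside  ∷ p) (outside ∷ q) = s≤s (∣p∣≤∣p∩∁q∣+∣q∣ p q)
∣p∣≤∣p∩∁q∣+∣q∣ (outside ∷ p) (inside  ∷ q) =
  ≤-trans (∣p∣≤∣p∩∁q∣+∣q∣ p q) (+-monoʳ-≤ ∣ p ∩ ∁ q ∣ (n≤1+n ∣ q ∣))
∣p∣≤∣p∩∁q∣+∣q∣ (outside ∷ p) (outside ∷ q) = ∣p∣≤∣p∩∁q∣+∣q∣ p q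

∣⋃A∣≤∑∣A∣ : (A : I → Subset n) (xs : List I) → ∣ ⋃ (map A xs) ∣ ≤ sum (map (∣_∣ ∘ A) xs)
∣⋃A∣≤∑∣A∣ {n = n} A []       = ≤-reflexive (∣⊥∣≡0 n)
∣⋃A∣≤∑∣A∣         A (x ∷ xs) =
  ≤-trans (∣p∪q∣≤∣p∣+∣q∣ (A x) (⋃ (map A xs))) (+-monoʳ-≤ ∣ A x ∣ (∣⋃A∣≤∑∣A∣ A xs))

∣p∩⋃A∣≤∑∣p∩A∣ : (p : Subset n) (A : I → Subset n) (xs : List I) →
                  ∣ p ∩ ⋃ (map A xs) ∣ ≤ sum (map (λ x → ∣ p ∩ A x ∣) xs)
∣p∩⋃A∣≤∑∣p∩A∣ {n = n} p A []       = ≤-trans (∣p∩q∣≤∣q∣ p ⊥) (≤-reflexive (∣⊥∣≡0 n))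
∣p∩⋃A∣≤∑∣p∩A∣         p A (x ∷ xs) = begin
  ∣ p ∩ (A x ∪ ⋃ (map A xs)) ∣           ≡⟨ cong ∣_∣ (∩-distribˡ-∪ p (A x) (⋃ (map A xs))) ⟩
  ∣ p ∩ A x ∪ p ∩ ⋃ (map A xs) ∣         ≤⟨ ∣p∪q∣≤∣p∣+∣q∣ (p ∩ A x) (p ∩ ⋃ (map A xs)) ⟩
  ∣ p ∩ A x ∣ + ∣ p ∩ ⋃ (map A xs) ∣     ≤⟨ +-monoʳ-≤ ∣ p ∩ A x ∣ (∣p∩⋃A∣≤∑∣p∩A∣ p A xs) ⟩
  ∣ p ∩ A x ∣ + sum (map (λ y → ∣ p ∩ A y ∣) xs) ∎
  where open ≤-Reasoning

fromList : List (Fin n) → Subset n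
fromList xs = ⋃ (map ⁅_⁆ xs)

∣fromList∣≤length : (xs : List (Fin n)) → ∣ fromList xs ∣ ≤ length xs
∣fromList∣≤length xs = ≤-trans (∣⋃A∣≤∑∣A∣ ⁅_⁆ xs) (≤-reflexive (sum-ones xs))
  where
  sum-ones : (xs : List (Fin n)) → sum (map (∣_∣ ∘ ⁅_⁆) xs) ≡ length xs
  sum-ones []       = refl
  sum-ones (x ∷ xs) = cong₂ _+_ (∣⁅x⁆∣≡1 x) (sum-ones xs)

∈-fromList⁺ : ∀ {x} {xs : List (Fin n)} → x ∈ xs → x ∈ₛ fromList xs
∈-fromList⁺ (here refl) = x∈p∪q⁺ (inj₁ (x∈⁅x⁆ _))
∈-fromList⁺ (there x∈)  = x∈p∪q⁺ (inj₂ (∈-fromList⁺ x∈))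

members : Subset n → List (Fin n)
members []            = []
members (inside  ∷ p) = zero ∷ map suc (members p)
members (outside ∷ p) = map suc (members p)

length-members : (p : Subset n) → length (members p) ≡ ∣ p ∣
length-members []            = refl
length-members (inside  ∷ p) = cong suc (≡.trans (length-map suc (members p)) (length-members p))
length-members (outside ∷ p) = ≡.trans (length-map suc (members p)) (length-members p)

members-unique : (p : Subset n) → Unique (members p)
members-unique []            = []
members-unique (inside  ∷ p) =
  All.map⁺ (All.universal (λ _ ()) (members p)) ∷ Unique.map⁺ Fin.suc-injective (members-unique p)
members-unique (outside ∷ p) = Unique.map⁺ Fin.suc-injective (members-unique p)

members-⊆ : (p : Subset n) → All (_∈ₛ p) (members p)
members-⊆ []            = []
members-⊆ (inside  ∷ p) = here ∷ All.map⁺ (All.map there (members-⊆ p))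
members-⊆ (outside ∷ p) = All.map⁺ (All.map there (members-⊆ p))

distinct-members : ∀ m (p : Subset n) → m ≤ ∣ p ∣ →
                   Σ (List (Fin n)) λ xs → length xs ≡ m × Unique xs × All (_∈ₛ p) xs
distinct-members m p m≤∣p∣ =
  take m (members p) ,
  ≡.trans (length-take m (members p)) (m≤n⇒m⊓n≡m (≤-trans m≤∣p∣ (≤-reflexive (≡.sym (length-members p))))) ,
  Unique.take⁺ m (members-unique p) ,
  All.take⁺ m (members-⊆ p)

[1+m]C2≡m+mC2 : ∀ m → suc m C 2 ≡ m + m C 2
[1+m]C2≡m+mC2 m = begin
  suc m C 2        ≡⟨ nCk+nC[k+1]≡[n+1]C[k+1] m 1 ⟨
  m C 1 + m C 2    ≡⟨ cong (_+ m C 2) (nC1≡n m) ⟩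
  m + m C 2        ∎
  where open ≡.≡-Reasoning

2*[1+m]C2≡[1+m]*m : ∀ m → 2 * (suc m C 2) ≡ suc m * m
2*[1+m]C2≡[1+m]*m zero    = refl
2*[1+m]C2≡[1+m]*m (suc m) = begin
  2 * (suc (suc m) C 2)            ≡⟨ cong (2 *_) ([1+m]C2≡m+mC2 (suc m)) ⟩
  2 * (suc m + suc m C 2)          ≡⟨ *-distribˡ-+ 2 (suc m) (suc m C 2) ⟩
  2 * suc m + 2 * (suc m C 2)      ≡⟨ cong (2 * suc m +_) (2*[1+m]C2≡[1+m]*m m) ⟩
  2 * suc m + suc m * m            ≡⟨ solve List.[ m ] ⟩
  suc (suc m) * suc m              ∎
  where open ≡.≡-Reasoning

pairSum : (I → I → ℕ) → List I → ℕ
pairSum w []       = 0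
pairSum w (x ∷ xs) = sum (map (w x) xs) + pairSum w xs

bonferroni : (A : I → Subset n) (xs : List I) →
             sum (map (∣_∣ ∘ A) xs) ≤ ∣ ⋃ (map A xs) ∣ + pairSum (λ x y → ∣ A x ∩ A y ∣) xs
bonferroni A []       = z≤n
bonferroni A (x ∷ xs) = begin
  ∣ A x ∣ + sum (map (∣_∣ ∘ A) xs)
    ≤⟨ +-monoʳ-≤ ∣ A x ∣ (bonferroni A xs) ⟩
  ∣ A x ∣ + (∣ ⋃As ∣ + pairs)
    ≡⟨ +-assoc ∣ A x ∣ ∣ ⋃As ∣ pairs ⟨
  ∣ A x ∣ + ∣ ⋃As ∣ + pairs
    ≡⟨ cong (_+ pairs) (∣p∪q∣+∣p∩q∣≡∣p∣+∣q∣ (A x) ⋃As) ⟨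
  ∣ A x ∪ ⋃As ∣ + ∣ A x ∩ ⋃As ∣ + pairs
    ≤⟨ +-monoˡ-≤ pairs (+-monoʳ-≤ ∣ A x ∪ ⋃As ∣ (∣p∩⋃A∣≤∑∣p∩A∣ (A x) A xs)) ⟩
  ∣ A x ∪ ⋃As ∣ + sum (map (λ y → ∣ A x ∩ A y ∣) xs) + pairs
    ≡⟨ +-assoc ∣ A x ∪ ⋃As ∣ _ pairs ⟩
  ∣ A x ∪ ⋃As ∣ + (sum (map (λ y → ∣ A x ∩ A y ∣) xs) + pairs)
    ∎
  where
  open ≤-Reasoning
  ⋃As = ⋃ (map A xs)
  pairs = pairSum (λ x y → ∣ A x ∩ A y ∣) xs

pairSum-≤ : ∀ {w : I → I → ℕ} {T} {xs : List I} →
            AllPairs (λ x y → w x y ≤ T) xs → pairSum w xs ≤ (length xs C 2) * T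
pairSum-≤ []                                          = z≤n
pairSum-≤ {w = w} {T} {xs = x ∷ xs} (wx≤T ∷ pairs≤T) = begin
  sum (map (w x) xs) + pairSum w xs      ≤⟨ +-mono-≤ (sum-≤ wx≤T) (pairSum-≤ pairs≤T) ⟩
  length xs * T + (length xs C 2) * T    ≡⟨ *-distribʳ-+ T (length xs) (length xs C 2) ⟨
  (length xs + length xs C 2) * T        ≡⟨ cong (_* T) ([1+m]C2≡m+mC2 (length xs)) ⟨
  (suc (length xs) C 2) * T              ∎
  where
  open ≤-Reasoning
  sum-≤ : ∀ {g : I → ℕ} {ys} → All (λ y → g y ≤ T) ys → sum (map g ys) ≤ length ys * T
  sum-≤ []             = z≤n
  sum-≤ (gy≤T ∷ gys≤T) = +-mono-≤ gy≤T (sum-≤ gys≤T)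

r+2≤f[r] : ∀ r → r + 2 ≤ f r
r+2≤f[r] 0 = ≤ᵇ⇒≤ _ _ tt
r+2≤f[r] 1 = ≤ᵇ⇒≤ _ _ tt
r+2≤f[r] 2 = ≤ᵇ⇒≤ _ _ tt
r+2≤f[r] r@(suc (suc (suc r'))) = ≤-trans (m≤m+n (r + 2) (2 * r + 2)) (≤-reflexive r+2+[2r+2]≡3r+4)
  where
  r+2+[2r+2]≡3r+4 : r + 2 + (2 * r + 2) ≡ 3 * r + 4
  r+2+[2r+2]≡3r+4 = solve List.[ r' ]

108-coefficient : ∀ r → 2 ≤ r → (r + 1) * (suc (2 * r + 2) * (2 * r + 2)) * 4 ≤ 108 * (r + 1) ^ r
108-coefficient 1 (s≤s ())
108-coefficient 2 _ = ≤ᵇ⇒≤ _ _ tt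
108-coefficient r@(suc (suc (suc r'))) _ = begin
  (r + 1) * (suc (2 * r + 2) * (2 * r + 2)) * 4
    ≤⟨ *-monoˡ-≤ 4 (*-monoʳ-≤ (r + 1) (*-monoˡ-≤ (2 * r + 2) 2r+3≤3[r+1])) ⟩
  (r + 1) * (3 * (r + 1) * (2 * r + 2)) * 4
    ≡⟨ solve List.[ r' ] ⟩
  24 * ((r + 1) * ((r + 1) * ((r + 1) * 1)))   -- (r + 1) ^ 3, unfolded for the ring solver
    ≤⟨ *-monoʳ-≤ 24 (^-monoʳ-≤ (r + 1) {3} {r} (s≤s (s≤s (s≤s z≤n)))) ⟩
  24 * (r + 1) ^ r
    ≤⟨ *-monoˡ-≤ ((r + 1) ^ r) (m≤m+n 24 84) ⟩
  108 * (r + 1) ^ r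
    ∎
  where
  open ≤-Reasoning
  2r+3≤3[r+1] : suc (2 * r + 2) ≤ 3 * (r + 1)
  2r+3≤3[r+1] = begin
    suc (2 * r + 2)      ≤⟨ m≤m+n (suc (2 * r + 2)) r ⟩
    suc (2 * r + 2) + r  ≡⟨ solve List.[ r' ] ⟩
    3 * (r + 1)          ∎

counting-bound : ∀ r k → 2 ≤ r → r + 2 ≤ k →
                 (2 * r + 2) * ((suc (2 * r + 2) C 2) * (2 * k + 2 * r + 2)) < 108 * (r + 1) ^ r * k
counting-bound 1 _ (s≤s ()) _
counting-bound r@(suc (suc r')) k 2≤r r+2≤k = begin-strict
  (2 * r + 2) * ((suc (2 * r + 2) C 2) * (2 * k + 2 * r + 2))
    ≡⟨ regroup r (suc (2 * r + 2) C 2) (2 * k + 2 * r + 2) ⟩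
  (r + 1) * (2 * (suc (2 * r + 2) C 2)) * (2 * k + 2 * r + 2)
    ≡⟨ cong (λ x → (r + 1) * x * (2 * k + 2 * r + 2)) (2*[1+m]C2≡[1+m]*m (2 * r + 2)) ⟩
  (r + 1) * (suc (2 * r + 2) * (2 * r + 2)) * (2 * k + 2 * r + 2)
    <⟨ *-monoʳ-< ((r + 1) * (suc (2 * r + 2) * (2 * r + 2))) 2k+2r+2<4k ⟩
  (r + 1) * (suc (2 * r + 2) * (2 * r + 2)) * (4 * k)
    ≡⟨ *-assoc ((r + 1) * (suc (2 * r + 2) * (2 * r + 2))) 4 k ⟨
  (r + 1) * (suc (2 * r + 2) * (2 * r + 2)) * 4 * k
    ≤⟨ *-monoˡ-≤ k (108-coefficient r 2≤r) ⟩
  108 * (r + 1) ^ r * k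
    ∎
  where
  open ≤-Reasoning
  regroup : ∀ a x t → (2 * a + 2) * (x * t) ≡ (a + 1) * (2 * x) * t
  regroup a x t = solve (a List.∷ x List.∷ List.[ t ])
  2k+2r+2<4k : 2 * k + 2 * r + 2 < 4 * k
  2k+2r+2<4k = begin-strict
    2 * k + 2 * r + 2        <⟨ +-monoʳ-< (2 * k + 2 * r) (≤ᵇ⇒≤ 3 4 tt) ⟩
    2 * k + 2 * r + 4        ≡⟨ solve (k List.∷ List.[ r' ]) ⟩
    2 * k + 2 * (r + 2)      ≤⟨ +-monoʳ-≤ (2 * k) (*-monoʳ-≤ 2 r+2≤k) ⟩
    2 * k + 2 * k            ≡⟨ solve List.[ k ] ⟩
    4 * k                    ∎

module _ {n} (G : Graph n) where

  Adj : Rel (Fin n) _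
  Adj u v = adj G u v ≡ true

  Adj-sym : ∀ {u v} → Adj u v → Adj v u
  Adj-sym {u} {v} uv = ≡.trans (sym G v u) uv

  ∈N⇒Adj : ∀ {u v} → v ∈ₛ N G u → Adj u v
  ∈N⇒Adj {u} {v} v∈ = ≡.trans (≡.sym (lookup∘tabulate (adj G u) v)) ([]=⇒lookup v∈)

  codeg : Fin n → Fin n → ℕ
  codeg u v = ∣ N G u ∩ N G v ∣

  E⇒Adj : (H : Subgraph G) → ∀ {u v} → E H u v → Adj u v
  E⇒Adj H {u} {v} e = proj₂ (proj₂ (E-sub H u v e))

  Chain⇒Cycle : ∀ {a b xs} → Chain Adj a xs b → Adj b a → Unique (a ∷ xs) → HasCycle G (length xs)
  Chain⇒Cycle walk ba uniq with Chain⇒IndexedPath walk uniq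
  ... | p , inj , steps , refl , refl = p , inj , steps , ba

  sum-deg≤n+pairSum-codeg : ∀ L → sum (map (deg G) L) ≤ n + pairSum codeg L
  sum-deg≤n+pairSum-codeg L =
    ≤-trans (bonferroni (N G) L) (+-monoˡ-≤ (pairSum codeg L) (∣p∣≤n (⋃ (map (N G) L))))

  minDeg⇒sum-deg : ∀ D → MinDegAtLeastFrac G D → ∀ L → length L * n ≤ D * sum (map (deg G) L)
  minDeg⇒sum-deg D δ []      = z≤n
  minDeg⇒sum-deg D δ (v ∷ L) =
    ≤-trans (+-mono-≤ (δ v) (minDeg⇒sum-deg D δ L)) (≤-reflexive (≡.sym (*-distribˡ-+ D (deg G v) _)))

  HasHeavyPairs : ℕ → ℕ → Set
  HasHeavyPairs m T = ∀ L → Unique L → length L ≡ m →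
                      ∃₂ λ u v → u ∈ L × v ∈ L × u ≢ v × T < codeg u v

  minDeg⇒HasHeavyPairs : ∀ D {T} → MinDegAtLeastFrac G D → D * ((suc D C 2) * T) < n →
                         HasHeavyPairs (suc D) T
  minDeg⇒HasHeavyPairs D {T} δ small L uniq |L|≡1+D
    with AllPairs-or-violation (λ u v → codeg u v ≤? T) L uniq
  ... | inj₂ (u , v , u∈ , v∈ , u≢v , heavy) = u , v , u∈ , v∈ , u≢v , ≰⇒> heavy
  ... | inj₁ light = contradiction n≤D*[C*T] (<⇒≱ small)
    where
    open ≤-Reasoning
    n≤D*[C*T] : n ≤ D * ((suc D C 2) * T)
    n≤D*[C*T] = +-cancelˡ-≤ (D * n) n _ (begin
      D * n + n                             ≡⟨ +-comm (D * n) n ⟩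
      suc D * n                             ≡⟨ cong (_* n) |L|≡1+D ⟨
      length L * n                          ≤⟨ minDeg⇒sum-deg D δ L ⟩
      D * sum (map (deg G) L)               ≤⟨ *-monoʳ-≤ D (sum-deg≤n+pairSum-codeg L) ⟩
      D * (n + pairSum codeg L)             ≤⟨ *-monoʳ-≤ D (+-monoʳ-≤ n (pairSum-≤ light)) ⟩
      D * (n + (length L C 2) * T)          ≡⟨ cong (λ ℓ → D * (n + (ℓ C 2) * T)) |L|≡1+D ⟩
      D * (n + (suc D C 2) * T)             ≡⟨ *-distribˡ-+ D n _ ⟩
      D * n + D * ((suc D C 2) * T)         ∎)

  CommonNbr : Fin n → Fin n → List (Fin n) → Fin n → Set
  CommonNbr a b S w = Adj a w × Adj b w × w ∉ S

  heavyCommonNbrs : ∀ {m T a b S} → HasHeavyPairs m T → m + length S ≤ suc T → T < codeg a b →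
                    ∃₂ λ u v → u ≢ v × CommonNbr a b S u × CommonNbr a b S v × T < codeg u v
  heavyCommonNbrs {m} {T} {a} {b} {S} heavy budget T<ab =
    let L , |L|≡m , uniq , L⊆candidates = distinct-members m candidates m≤∣candidates∣
        u , v , u∈ , v∈ , u≢v , T<uv    = heavy L uniq |L|≡m
    in  u , v , u≢v , common (All.lookup L⊆candidates u∈) , common (All.lookup L⊆candidates v∈) , T<uv
    where
    candidates : Subset n
    candidates = (N G a ∩ N G b) ∩ ∁ (fromList S)
    m≤∣candidates∣ : m ≤ ∣ candidates ∣
    m≤∣candidates∣ = +-cancelʳ-≤ (length S) m ∣ candidates ∣ (begin
      m + length S                              ≤⟨ budget ⟩
      suc T                                     ≤⟨ T<ab ⟩
      ∣ N G a ∩ N G b ∣                         ≤⟨ ∣p∣≤∣p∩∁q∣+∣q∣ (N G a ∩ N G b) (fromList S) ⟩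
      ∣ candidates ∣ + ∣ fromList S ∣           ≤⟨ +-monoʳ-≤ ∣ candidates ∣ (∣fromList∣≤length S) ⟩
      ∣ candidates ∣ + length S                 ∎)
      where open ≤-Reasoning
    common : ∀ {w} → w ∈ₛ candidates → CommonNbr a b S w
    common w∈ with x∈p∩q⁻ (N G a ∩ N G b) _ w∈
    ... | w∈ab , w∉S with x∈p∩q⁻ (N G a) (N G b) w∈ab
    ...   | w∈a , w∈b = ∈N⇒Adj w∈a , ∈N⇒Adj w∈b , x∈∁p⇒x∉p w∉S ∘ ∈-fromList⁺

  record Detour (a b : Fin n) (S : List (Fin n)) (ℓ : ℕ) : Set where
    field
      interior        : List (Fin n)
      end             : Fin n
      walk            : Chain Adj a interior end
      closing         : Adj end b
      length-interior : length interior ≡ ℓ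
      unique          : Unique interior
      avoids          : All (_∉ S) interior

  detour-via : ∀ {a b S u v ℓ} → u ≢ v → CommonNbr a b S u → CommonNbr a b S v →
               Detour u v (u ∷ v ∷ S) ℓ → Detour a b S (2 + ℓ)
  detour-via {S = S} {u} {v} {ℓ} u≢v (au , _ , u∉S) (_ , bv , v∉S) d = record
    { interior        = u ∷ interior ++ v ∷ []
    ; end             = v
    ; walk            = au ◅ (walk ◅◅ (closing ◅ ε))
    ; closing         = Adj-sym bv
    ; length-interior = cong suc |interior++v|≡1+ℓ
    ; unique          = All.++⁺ u≢interior (u≢v ∷ []) ∷ Unique.++⁺ unique ([] ∷ []) v∉interior
    ; avoids          = u∉S ∷ All.++⁺ interior-avoids-S (v∉S ∷ [])
    }
    where
    open Detour d
    |interior++v|≡1+ℓ : length (interior ++ v ∷ []) ≡ suc ℓ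
    |interior++v|≡1+ℓ =
      ≡.trans (length-++ interior) (≡.trans (+-comm (length interior) 1) (cong suc length-interior))
    u≢interior : All (u ≢_) interior
    u≢interior = All.map (λ z∉ u≡z → z∉ (here (≡.sym u≡z))) avoids
    v∉interior : Disjoint interior (v ∷ [])
    v∉interior (z∈ , here refl) = All.lookup avoids z∈ (there (here refl))
    interior-avoids-S : All (_∉ S) interior
    interior-avoids-S = All.map (λ z∉ z∈S → z∉ (there (there z∈S))) avoids

  detour : ∀ {m T a b S} → HasHeavyPairs m T → ∀ s → m + length S + 2 * s ≤ suc T → T < codeg a b →
           Detour a b S (suc (2 * s))
  detour {a = a} {b} {S} heavy s budget T<ab
    with heavyCommonNbrs {a = a} {b} {S} heavy (≤-trans (m≤m+n _ (2 * s)) budget) T<ab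
  detour heavy zero _ _ | u , _ , _ , (au , bu , u∉S) , _ = record
    { interior = u ∷ [] ; end = u ; walk = au ◅ ε ; closing = Adj-sym bu
    ; length-interior = refl ; unique = [] ∷ [] ; avoids = u∉S ∷ [] }
  detour {m} {T} {S = S} heavy (suc s) budget _ | u , v , u≢v , u-common , v-common , T<uv =
    subst (Detour _ _ S) (cong suc (≡.sym (*-suc 2 s)))
      (detour-via u≢v u-common v-common (detour heavy s budget′ T<uv))
    where
    regroup : ∀ m ℓ s → m + suc (suc ℓ) + 2 * s ≡ m + ℓ + 2 * suc s
    regroup m ℓ s = solve (m List.∷ ℓ List.∷ List.[ s ])
    budget′ : m + length (u ∷ v ∷ S) + 2 * s ≤ suc T
    budget′ = ≤-trans (≤-reflexive (regroup m (length S) s)) budget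

  evenPath⇒oddCycle : ∀ {m T k x y} → HasHeavyPairs m T → m + 2 * k ≤ suc T → T < codeg x y →
                          (H : Subgraph G) → EvenPathAtMost H k y x → HasCycle G (2 * k)
  evenPath⇒oddCycle {m} {T} {k} {x} {y} heavy budget T<xy H (l , (j , 1+l≡2j) , 1+l≤2k , path)
    with IndexedPath⇒Chain path
  ... | P , walkP , uniqP , |P|≡l =
    subst (HasCycle G) |P++interior|≡2k
      (Chain⇒Cycle (Chain-map (E⇒Adj H) walkP ◅◅ walk) closing
                   (Unique.++⁺ uniqP unique (λ (z∈yP , z∈interior) → All.lookup avoids z∈interior z∈yP)))
    where
    j≤k : j ≤ k
    j≤k = *-cancelˡ-≤ 2 (subst (_≤ 2 * k) 1+l≡2j 1+l≤2k)
    2j+2[k∸j]≡2k : 2 * j + 2 * (k ∸ j) ≡ 2 * k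
    2j+2[k∸j]≡2k = ≡.trans (≡.sym (*-distribˡ-+ 2 j (k ∸ j)))
                           (cong (2 *_) (m+[n∸m]≡n j≤k))
    |yP|≡2j : length (y ∷ P) ≡ 2 * j
    |yP|≡2j = ≡.trans (cong suc |P|≡l) 1+l≡2j
    budget′ : m + length (y ∷ P) + 2 * (k ∸ j) ≤ suc T
    budget′ = ≤-trans (≤-reflexive (begin
      m + length (y ∷ P) + 2 * (k ∸ j)   ≡⟨ cong (λ t → m + t + 2 * (k ∸ j)) |yP|≡2j ⟩
      m + 2 * j + 2 * (k ∸ j)            ≡⟨ +-assoc m (2 * j) _ ⟩
      m + (2 * j + 2 * (k ∸ j))          ≡⟨ cong (m +_) 2j+2[k∸j]≡2k ⟩
      m + 2 * k                          ∎)) budget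
      where open ≡.≡-Reasoning
    open Detour (detour {a = x} {b = y} {S = y ∷ P} heavy (k ∸ j) budget′ T<xy)
    |P++interior|≡2k : length (P ++ interior) ≡ 2 * k
    |P++interior|≡2k = begin
      length (P ++ interior)          ≡⟨ length-++ P ⟩
      length P + length interior      ≡⟨ cong₂ _+_ |P|≡l length-interior ⟩
      l + suc (2 * (k ∸ j))           ≡⟨ +-suc l _ ⟩
      suc l + 2 * (k ∸ j)             ≡⟨ cong (_+ 2 * (k ∸ j)) 1+l≡2j ⟩
      2 * j + 2 * (k ∸ j)             ≡⟨ 2j+2[k∸j]≡2k ⟩
      2 * k                           ∎
      where open ≡.≡-Reasoning

lemma3p2 : (r k n : ℕ) → 2 ≤ r → 108 * ((r + 1) ^ r) * k ≤ n → f r ≤ k →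
    (G : Graph n) → ¬ HasCycle G (2 * k) →
    MinDegAtLeastFrac G (2 * r + 2) →
    (H : Subgraph G) → Is2kCore k H → ∣ V H ∣ ≤ 2 * r + 2
lemma3p2 r k n 2≤r n-large f[r]≤k G noCycle δ H core with ∣ V H ∣ ≤? 2 * r + 2
... | yes small = small
... | no large =
  let L , |L|≡2r+3 , uniq , L⊆V = distinct-members (suc (2 * r + 2)) (V H) (≰⇒> large)
      x , y , x∈ , y∈ , x≢y , T<xy = heavy L uniq |L|≡2r+3
      yx-path = core y x (All.lookup L⊆V y∈) (All.lookup L⊆V x∈) (x≢y ∘ ≡.sym)
  in  contradiction (evenPath⇒oddCycle G {k = k} heavy budget T<xy H yx-path) noCycle
  where
  heavy : HasHeavyPairs G (suc (2 * r + 2)) (2 * k + 2 * r + 2)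
  heavy = minDeg⇒HasHeavyPairs G (2 * r + 2) δ
            (<-≤-trans (counting-bound r k 2≤r (≤-trans (r+2≤f[r] r) f[r]≤k)) n-large)
  budget : suc (2 * r + 2) + 2 * k ≤ suc (2 * k + 2 * r + 2)
  budget = ≤-reflexive (solve (r List.∷ List.[ k ]))
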